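{- Let $(\operatorname{flow}(k))_{k\in\mathbb{N}}$ be a unidirectional flow-firing configuration (finitely many nonzero terms) such that $\operatorname{flow}(k)\ge 0$ for all $k$ and the sequence $\operatorname{flow}(0),\operatorname{flow}(1),\operatorname{flow}(2),\dots$ is weakly decreasing. Then this configuration satisfies the diamond lemma: for every configuration $c$ reachable from it by a finite sequence of firing moves, if $c$ can be transformed in one firing move into $c_1$ and also in one firing move into $c_2$, where $c_1\neq c_2$, then there exists a configuration $c_3$ that can be reached by one firing move from $c_1$ and by one firing move from $c_2$.
   Context: Flow-firing in face representation: a configuration assigns an integer value $\operatorname{flow}(F)$ to each face $F$ of a planar graph. A firing move chooses two faces $F,G$ sharing an edge with $\operatorname{flow}(F)-\operatorname{flow}(G)\ge 2$ and replaces $\operatorname{flow}(F)$ by $\operatorname{flow}(F)-1$ and $\operatorname{flow}(G)$ by $\operatorname{flow}(G)+1$. A unidirectional flow-firing configuration is such a configuration on the planar graph isomorphic to the $\mathbb{N}$ lattice: a one-dimensional strip of square faces indexed by $0,1,2,\dots$, where faces $i$ and $j$ share an edge iff $|i-j|=1$. Its sequence of flow is $(\operatorname{flow}(0),\operatorname{flow}(1),\dots)$, the $k$-th term being the flow of face $k$. -}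

module Defs where

open import Data.Nat as ℕ using (ℕ; suc)
open import Data.Integer using (ℤ; _-_; _+_; _≤_; +_; 0ℤ; 1ℤ)
open import Data.Product using (Σ; ∃; _×_)
open import Data.Sum using (_⊎_)
open import Relation.Binary.PropositionalEquality using (_≡_; _≢_)
open import Relation.Binary.Construct.Closure.ReflexiveTransitive using (Star)
open import Relation.Nullary using (¬_)

Config : Set
Config = ℕ → ℤ

-- Faces i and j of the ℕ-strip share an edge iff |i - j| = 1.
Adjacent : ℕ → ℕ → Set
Adjacent i j = (j ≡ suc i) ⊎ (i ≡ suc j)

-- Configurations are compared pointwise (avoids function extensionality).
_≈_ : Config → Config → Set
c ≈ d = ∀ k → c k ≡ d k

FireAt : ℕ → ℕ → Config → Config → Set
FireAt i j c d =
  Adjacent i j × (+ 2 ≤ c i - c j) ×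
  (d i ≡ c i - 1ℤ) × (d j ≡ c j + 1ℤ) ×
  (∀ k → k ≢ i → k ≢ j → d k ≡ c k)

Fire : Config → Config → Set
Fire c d = ∃ λ i → ∃ λ j → FireAt i j c d

Reachable : Config → Config → Set
Reachable = Star Fire

FiniteSupport : Config → Set
FiniteSupport c = ∃ λ N → ∀ k → N ℕ.≤ k → c k ≡ 0ℤ

DiamondLemma : Config → Set
DiamondLemma c₀ = ∀ c c₁ c₂ → Reachable c₀ c → Fire c c₁ → Fire c c₂ →
  ¬ (c₁ ≈ c₂) → ∃ λ c₃ → Fire c₁ c₃ × Fire c₂ c₃

-- On a weakly decreasing configuration no face can fire backwards (that would
-- need flow(j+1) - flow(j) ≥ 2), so every move fires from some face i into
-- i+1, i.e. adds the vector firing i = -e_i + e_{i+1}; such a move keeps the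
-- configuration decreasing, hence every reachable configuration is decreasing.
-- Two distinct moves i ≠ j commute: firing i only widens the gap
-- flow(j) - flow(j+1), so j can still fire afterwards and vice versa, and both
-- orders add the same vector.
module Submission where

open import Defs
open import Data.Nat using (ℕ; zero; suc; z≤n)
open import Data.Integer using (_≤_; 0ℤ)

open import Data.Nat.Properties using (_≟_)
open import Data.Integer using (ℤ; _+_; _-_; -_; +_; +≤+; 1ℤ; -1ℤ)
open import Data.Integer.Properties
  using (≤-trans; ≤-reflexive; +-monoʳ-≤; +-identityʳ; i≤j⇒0≤j-i; 0≤i-j⇒j≤i; i≤j⇒i-j≤0)
open import Data.Integer.Tactic.RingSolver using (solve-∀)
open import Data.Product using (∃; _×_; _,_)
open import Data.Sum using (inj₁; inj₂)
open import Data.Empty using (⊥-elim)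
open import Function using (_∘_)
open import Relation.Nullary using (¬_; yes; no)
open import Relation.Binary.PropositionalEquality
  using (_≡_; _≢_; refl; sym; trans; cong; cong₂; subst; subst₂)
open import Relation.Binary.Construct.Closure.ReflexiveTransitive using (ε; _◅_)

Decreasing : Config → Set
Decreasing c = ∀ k → c (suc k) ≤ c k

gap : Config → ℕ → ℤ
gap c k = c k - c (suc k)

firing : ℕ → ℕ → ℤ
firing zero    zero          = -1ℤ
firing zero    (suc zero)    = 1ℤ
firing zero    (suc (suc k)) = 0ℤ
firing (suc i) zero          = 0ℤ
firing (suc i) (suc k)       = firing i k

fire : ℕ → Config → Config
fire i c k = c k + firing i k

firing-self : ∀ i → firing i i ≡ -1ℤ
firing-self zero    = refl
firing-self (suc i) = firing-self i

firing-suc : ∀ i → firing i (suc i) ≡ 1ℤ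
firing-suc zero    = refl
firing-suc (suc i) = firing-suc i

firing-other : ∀ {i k} → k ≢ i → k ≢ suc i → firing i k ≡ 0ℤ
firing-other {zero}  {zero}          k≢i _     = ⊥-elim (k≢i refl)
firing-other {zero}  {suc zero}      _   k≢1+i = ⊥-elim (k≢1+i refl)
firing-other {zero}  {suc (suc k)}   _   _     = refl
firing-other {suc i} {zero}          _   _     = refl
firing-other {suc i} {suc k}         k≢i k≢1+i =
  firing-other (k≢i ∘ cong suc) (k≢1+i ∘ cong suc)

firing-drop-self : ∀ i → firing i i - firing i (suc i) ≡ - + 2
firing-drop-self zero    = refl
firing-drop-self (suc i) = firing-drop-self i

firing-drop-other : ∀ {i k} → k ≢ i → 0ℤ ≤ firing i k - firing i (suc k)
firing-drop-other {zero}        {zero}        k≢i = ⊥-elim (k≢i refl)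
firing-drop-other {zero}        {suc zero}    _   = +≤+ z≤n
firing-drop-other {zero}        {suc (suc k)} _   = +≤+ z≤n
firing-drop-other {suc zero}    {zero}        _   = +≤+ z≤n
firing-drop-other {suc (suc i)} {zero}        _   = +≤+ z≤n
firing-drop-other {suc i}       {suc k}       k≢i = firing-drop-other (k≢i ∘ cong suc)

fire-cong : ∀ i {c d} → c ≈ d → fire i c ≈ fire i d
fire-cong i c≈d k = cong (_+ firing i k) (c≈d k)

fire-comm : ∀ i j c → fire i (fire j c) ≈ fire j (fire i c)
fire-comm i j c k = swap (c k) (firing j k) (firing i k)
  where
  swap : ∀ x a b → (x + a) + b ≡ (x + b) + a
  swap = solve-∀

gap-cong : ∀ {c d} → c ≈ d → ∀ k → gap c k ≡ gap d k
gap-cong c≈d k = cong₂ _-_ (c≈d k) (c≈d (suc k))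

gap-fire : ∀ i c k → gap (fire i c) k ≡ gap c k + (firing i k - firing i (suc k))
gap-fire i c k = interchange (c k) (c (suc k)) (firing i k) (firing i (suc k))
  where
  interchange : ∀ x y a b → (x + a) - (y + b) ≡ (x - y) + (a - b)
  interchange = solve-∀

gap-fire-other : ∀ {i k} c → k ≢ i → gap c k ≤ gap (fire i c) k
gap-fire-other {i} {k} c k≢i = subst₂ _≤_
  (+-identityʳ (gap c k)) (sym (gap-fire i c k))
  (+-monoʳ-≤ (gap c k) (firing-drop-other k≢i))

fire-decreasing : ∀ {i c} → Decreasing c → + 2 ≤ gap c i → Decreasing (fire i c)
fire-decreasing {i} {c} dec firable = 0≤i-j⇒j≤i ∘ gap-nonneg
  where
  gap-nonneg : ∀ k → 0ℤ ≤ gap (fire i c) k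
  gap-nonneg k with k ≟ i
  ... | yes refl = subst (0ℤ ≤_)
    (sym (trans (gap-fire i c k) (cong (_+_ (gap c k)) (firing-drop-self k))))
    (i≤j⇒0≤j-i firable)
  ... | no k≢i = ≤-trans (i≤j⇒0≤j-i (dec k)) (gap-fire-other c k≢i)

fireAt-fire : ∀ {i c d} → + 2 ≤ gap c i → d ≈ fire i c → FireAt i (suc i) c d
fireAt-fire {i} {c} firable d≈ =
  inj₁ refl , firable ,
  trans (d≈ i) (cong (_+_ (c i)) (firing-self i)) ,
  trans (d≈ (suc i)) (cong (_+_ (c (suc i))) (firing-suc i)) ,
  λ k k≢i k≢1+i → trans (d≈ k) (trans (cong (_+_ (c k)) (firing-other k≢i k≢1+i)) (+-identityʳ (c k)))

fireAt⇒fire : ∀ {i c d} → FireAt i (suc i) c d → d ≈ fire i c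
fireAt⇒fire {i} {c} (_ , _ , at-i , at-1+i , elsewhere) k with k ≟ i | k ≟ suc i
... | yes refl | _        = trans at-i (cong (_+_ (c k)) (sym (firing-self k)))
... | no _     | yes refl = trans at-1+i (cong (_+_ (c k)) (sym (firing-suc i)))
... | no k≢i   | no k≢1+i = trans (elsewhere k k≢i k≢1+i)
  (trans (sym (+-identityʳ (c k))) (cong (_+_ (c k)) (sym (firing-other k≢i k≢1+i))))

Fire-decreasing⇒fire : ∀ {c d} → Decreasing c → Fire c d → ∃ λ i → + 2 ≤ gap c i × d ≈ fire i c
Fire-decreasing⇒fire dec (i , j , fa@(inj₁ refl , firable , _)) = i , firable , fireAt⇒fire fa
Fire-decreasing⇒fire dec (i , j , (inj₂ refl , firable , _))
  with ≤-trans firable (i≤j⇒i-j≤0 (dec j))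
... | +≤+ ()

Fire-decreasing : ∀ {c d} → Decreasing c → Fire c d → Decreasing d
Fire-decreasing dec move k with Fire-decreasing⇒fire dec move
... | i , firable , d≈ = subst₂ _≤_ (sym (d≈ (suc k))) (sym (d≈ k)) (fire-decreasing dec firable k)

Reachable-decreasing : ∀ {c d} → Decreasing c → Reachable c d → Decreasing d
Reachable-decreasing dec ε            = dec
Reachable-decreasing dec (move ◅ path) = Reachable-decreasing (Fire-decreasing dec move) path

fireAt-after-other : ∀ {i j c c₁ d} → j ≢ i → + 2 ≤ gap c j →
  c₁ ≈ fire i c → d ≈ fire j (fire i c) → FireAt j (suc j) c₁ d
fireAt-after-other {i} {j} {c} j≢i firable c₁≈ d≈ = fireAt-fire
  (≤-trans firable (≤-trans (gap-fire-other c j≢i) (≤-reflexive (sym (gap-cong c₁≈ j)))))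
  (λ k → trans (d≈ k) (sym (fire-cong j c₁≈ k)))

diamond-decreasing : ∀ {c c₁ c₂} → Decreasing c → Fire c c₁ → Fire c c₂ →
  ¬ (c₁ ≈ c₂) → ∃ λ c₃ → Fire c₁ c₃ × Fire c₂ c₃
diamond-decreasing {c} dec move₁ move₂ c₁≉c₂
  with Fire-decreasing⇒fire dec move₁ | Fire-decreasing⇒fire dec move₂
... | i , firable-i , c₁≈ | j , firable-j , c₂≈ with i ≟ j
...   | yes refl = ⊥-elim (c₁≉c₂ λ k → trans (c₁≈ k) (sym (c₂≈ k)))
...   | no i≢j = fire j (fire i c) ,
  (j , suc j , fireAt-after-other {c = c} (i≢j ∘ sym) firable-j c₁≈ (λ _ → refl)) ,
  (i , suc i , fireAt-after-other {c = c} i≢j firable-i c₂≈ (fire-comm j i c))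

mainTheorem1 : (flow : Config) → FiniteSupport flow →
    (∀ k → 0ℤ ≤ flow k) → (∀ k → flow (suc k) ≤ flow k) →
    DiamondLemma flow
mainTheorem1 flow _ _ dec c c₁ c₂ path =
  diamond-decreasing (Reachable-decreasing dec path)
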